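{- The multiplication of quasisymmetric Schur $P$-functions is not $\widehat P$-positive: there exist peak compositions $\alpha,\beta$ such that $\widehat P_\alpha\widehat P_\beta$ cannot be written as a linear combination with nonnegative coefficients of the functions $\widehat P_\gamma$, $\gamma$ a peak composition.
   Context: A peak composition is a composition in which no part except possibly the last equals $1$; diagrams are in English notation with left-justified rows, row $i$ from the top having $\alpha_i$ boxes. $M_\beta(X)=\sum_{i_1<\cdots<i_m}x_{i_1}^{\beta_1}\cdots x_{i_m}^{\beta_m}$. A peak composition tableau of shape $\alpha$: filling with positive integers, rows weakly increasing left to right, first column strictly increasing top to bottom, and for every $k$ the row lengths (top to bottom, omitting empty rows) of the cells with entries $\le k$ form a peak composition; $\mathrm{wt}(T)_i$ = number of entries $i$; $PCT(\alpha)$ = those with no value skipped. For $T\in PCT(\alpha)$, $p(T)=\sum_i(\#\text{distinct entries in row } i-1)$, $m(T)$ = number of first-column boxes whose box immediately below and box immediately to the right contain the same number. The quasisymmetric Schur $P$-function is $\widehat P_\alpha=\sum_{T\in PCT(\alpha)}2^{p(T)-m(T)}M_{\mathrm{wt}(T)}$. -}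

module Defs where

open import Data.Bool using (Bool; true; false; _∧_; _∨_; if_then_else_; T)
open import Data.Nat as ℕ using (ℕ; zero; suc; _∸_; _≡ᵇ_; _≤ᵇ_; _<ᵇ_)
open import Data.List using (List; []; _∷_; [_]; map; concatMap; filterᵇ; length; foldr; zipWith; upTo; deduplicate)
open import Data.Bool.ListAction using (all)
open import Data.Nat.ListAction using (sum)
open import Data.Product using (_×_; _,_)
open import Data.Integer using (+_)
open import Data.Rational using (ℚ; 0ℚ; 1ℚ; ½; _+_; _*_; _/_)

-- Compositions are lists of natural numbers (parts listed top to bottom).

isPeak : List ℕ → Bool
isPeak []          = true
isPeak (a ∷ [])    = 1 ≤ᵇ a
isPeak (a ∷ b ∷ r) = (2 ≤ᵇ a) ∧ isPeak (b ∷ r)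

Peak : List ℕ → Set
Peak α = T (isPeak α)

size : List ℕ → ℕ
size = sum

range : ℕ → ℕ → List ℕ
range lo hi = map (ℕ._+ lo) (upTo (suc hi ∸ lo))

-- Fillings of the diagram of α (row i has α_i boxes, English notation,
-- left justified) with entries in {1,…,N}.  A tableau is the list of its rows.

Tableau : Set
Tableau = List (List ℕ)

rowsOf : ℕ → ℕ → List (List ℕ)
rowsOf N zero    = [ [] ]
rowsOf N (suc a) = concatMap (λ x → map (x ∷_) (rowsOf N a)) (range 1 N)

fillings : ℕ → List ℕ → List Tableau
fillings N []      = [ [] ]
fillings N (a ∷ α) = concatMap (λ r → map (r ∷_) (fillings N α)) (rowsOf N a)

weaklyInc : List ℕ → Bool
weaklyInc []          = true
weaklyInc (x ∷ [])    = true
weaklyInc (x ∷ y ∷ r) = (x ≤ᵇ y) ∧ weaklyInc (y ∷ r)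

strictlyInc : List ℕ → Bool
strictlyInc []          = true
strictlyInc (x ∷ [])    = true
strictlyInc (x ∷ y ∷ r) = (x <ᵇ y) ∧ strictlyInc (y ∷ r)

firstColumn : Tableau → List ℕ
firstColumn []             = []
firstColumn ([] ∷ t)       = firstColumn t
firstColumn ((x ∷ _) ∷ t)  = x ∷ firstColumn t

count : (ℕ → Bool) → List ℕ → ℕ
count P []      = 0
count P (x ∷ r) = if P x then suc (count P r) else count P r

maxEntry : Tableau → ℕ
maxEntry t = foldr ℕ._⊔_ 0 (concatMap (λ r → r) t)

restrictShape : ℕ → Tableau → List ℕ
restrictShape k t = filterᵇ (λ n → 1 ≤ᵇ n) (map (count (λ x → x ≤ᵇ k)) t)

-- Since entries lie in 1..N, the restricted
-- shape is constant for k ≥ N, so k ranging over 0..N covers every k.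
isPeakTableau : ℕ → Tableau → Bool
isPeakTableau N t =
  all weaklyInc t ∧ strictlyInc (firstColumn t) ∧ all (λ k → isPeak (restrictShape k t)) (range 0 N)

noSkip : Tableau → Bool
noSkip t = all (λ v → 1 ≤ᵇ count (λ x → x ≡ᵇ v) (concatMap (λ r → r) t)) (range 1 (maxEntry t))

wt : Tableau → List ℕ
wt t = map (λ v → count (λ x → x ≡ᵇ v) (concatMap (λ r → r) t)) (range 1 (maxEntry t))

-- PCT(α): all peak composition tableaux of shape α with no value skipped.
-- Entries of such a tableau are ≤ size α (no value skipped), so enumerating
-- fillings with entries in 1..size α loses nothing.
PCT : List ℕ → List Tableau
PCT α = filterᵇ (λ t → isPeakTableau (size α) t ∧ noSkip t) (fillings (size α) α)

distinct : List ℕ → ℕ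
distinct r = length (deduplicate ℕ._≟_ r)

pStat : Tableau → ℕ
pStat t = sum (map (λ r → distinct r ∸ 1) t)

-- m(T) = number of first-column boxes whose box immediately below and box
-- immediately to the right both exist and contain the same number
mStat : Tableau → ℕ
mStat []                           = 0
mStat (r ∷ [])                     = 0
mStat ((x ∷ y ∷ r) ∷ (z ∷ s) ∷ t) = (if y ≡ᵇ z then 1 else 0) ℕ.+ mStat ((z ∷ s) ∷ t)
mStat (_ ∷ r' ∷ t)                 = mStat (r' ∷ t)

-- Formal power series in x₁, x₂, … with rational coefficients, given by
-- the coefficient of each monomial x₁^{e₁}⋯x_n^{e_n} (exponent list e;
-- trailing zeros do not change the monomial).

Series : Set
Series = List ℕ → ℚ

fromℕ : ℕ → ℚ
fromℕ n = + n / 1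

pow : ℚ → ℕ → ℚ
pow q zero    = 1ℚ
pow q (suc n) = q * pow q n

sumℚ : List ℚ → ℚ
sumℚ = foldr _+_ 0ℚ

eqList : List ℕ → List ℕ → Bool
eqList []      []      = true
eqList (x ∷ a) (y ∷ b) = (x ≡ᵇ y) ∧ eqList a b
eqList _       _       = false

support : List ℕ → List ℕ
support = filterᵇ (λ n → 1 ≤ᵇ n)

-- M_β = Σ_{i₁<⋯<i_m} x_{i₁}^{β₁}⋯x_{i_m}^{β_m}: coefficient of x^e is 1 iff the
-- nonzero exponents of e, read in order, are β.
M : List ℕ → Series
M β e = if eqList (support e) β then 1ℚ else 0ℚ

Phat : List ℕ → Series
Phat α e = sumℚ (map (λ t → (pow (fromℕ 2) (pStat t) * pow ½ (mStat t)) * M (wt t) e) (PCT α))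

below : List ℕ → List (List ℕ)
below []      = [ [] ]
below (a ∷ e) = concatMap (λ x → map (x ∷_) (below e)) (range 0 a)

_⊛_ : Series → Series → Series
(F ⊛ G) e = sumℚ (map (λ e₁ → F e₁ * G (zipWith _∸_ e e₁)) (below e))

linComb : List (List ℕ × ℚ) → Series
linComb L e = sumℚ (map (λ { (γ , c) → c * Phat γ e }) L)

-- Every P̂_γ has nonnegative coefficients, and for every peak composition γ the coefficient
-- of x₁x₂x₃³ in P̂_γ is at most that of x₁x₂³x₃: if |γ| ≠ 5 the former vanishes for degree
-- reasons (the weight of a tableau sums to its number of boxes), and the compositions of 5
-- are checked by evaluation.  This inequality is inherited by every nonnegative combination
-- of P̂_γ's, but fails for P̂_(2,2) P̂_(1), whose two coefficients are 4 and 3.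
module Submission where

open import Defs
open import Data.Bool using (true; false; T)
open import Data.Bool.Properties using (T?)
open import Data.Empty using (⊥-elim)
open import Data.List using (List; []; _∷_; [_]; map; length; concatMap; upTo; _++_; foldr)
open import Data.List.Membership.Propositional using (_∈_)
open import Data.List.Membership.Propositional.Properties using (∈-map⁺; ∈-++⁺ˡ; ∈-++⁺ʳ; ∈-upTo⁺)
open import Data.List.Properties using (length-++)
open import Data.List.Relation.Unary.All using (All; []; _∷_; all?)
import Data.List.Relation.Unary.All as All
import Data.List.Relation.Unary.All.Properties as All
open import Data.List.Relation.Unary.Any using (here; there)
open import Data.List.Relation.Unary.AllPairs using (_∷_)
open import Data.List.Relation.Unary.Unique.Propositional using (Unique)
import Data.List.Relation.Unary.Unique.Propositional.Properties as Unique
open import Data.Nat as ℕ using (ℕ; zero; suc; z≤n; s≤s; _≡ᵇ_; _⊔_)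
import Data.Nat.Properties as ℕ
open import Data.Nat.ListAction using (sum)
open import Algebra.Properties.CommutativeSemigroup ℕ.+-commutativeSemigroup using (x∙yz≈y∙xz)
open import Data.Product using (Σ; _×_; _,_; proj₁; proj₂)
open import Data.Rational using (ℚ; 0ℚ; 1ℚ; ½; _≤_; _+_; _*_; nonNegative)
open import Data.Rational.Properties using (_≤?_; ≤-refl; +-mono-≤; *-zeroʳ; *-monoˡ-≤-nonNeg; nonNeg*nonNeg⇒nonNeg; nonNegative⁻¹)
open import Data.Unit using (tt)
open import Function using (_∘_)
open import Relation.Binary.PropositionalEquality using (_≡_; _≢_; refl; sym; trans; cong; cong₂; subst; subst₂; module ≡-Reasoning)
open import Relation.Nullary using (¬_; yes; no)
open import Relation.Nullary.Decidable using (toWitness; toWitnessFalse; from-yes)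

Positive : List ℕ → Set
Positive = All (0 ℕ.<_)

peak⇒positive : ∀ γ → Peak γ → Positive γ
peak⇒positive []                    _ = []
peak⇒positive (a ∷ [])              p = ℕ.≤ᵇ⇒≤ 1 a p ∷ []
peak⇒positive (suc (suc a) ∷ b ∷ γ) p = s≤s z≤n ∷ peak⇒positive (b ∷ γ) p

incrHead : List ℕ → List ℕ
incrHead []      = []
incrHead (a ∷ γ) = suc a ∷ γ

compositions : ℕ → List (List ℕ)
compositions zero          = [ [] ]
compositions (suc zero)    = [ [ 1 ] ]
compositions (suc (suc n)) = map (1 ∷_) (compositions (suc n)) ++ map incrHead (compositions (suc n))

∈-compositions : ∀ n γ → Positive γ → sum γ ≡ n → γ ∈ compositions n
∈-compositions zero          []                _                 _  = here refl
∈-compositions zero          (_ ∷ _)           (s≤s _ ∷ _)       ()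
∈-compositions (suc zero)    (1 ∷ [])          _                 _  = here refl
∈-compositions (suc zero)    (1 ∷ _ ∷ _)       (_ ∷ s≤s _ ∷ _)   ()
∈-compositions (suc zero)    (suc (suc _) ∷ _) _                 ()
∈-compositions (suc (suc n)) (1 ∷ γ)           (_ ∷ pos)         eq =
  ∈-++⁺ˡ (∈-map⁺ (1 ∷_) (∈-compositions (suc n) γ pos (ℕ.suc-injective eq)))
∈-compositions (suc (suc n)) (suc (suc a) ∷ γ) (_ ∷ pos)         eq =
  ∈-++⁺ʳ _ (∈-map⁺ incrHead (∈-compositions (suc n) (suc a ∷ γ) (s≤s z≤n ∷ pos) (ℕ.suc-injective eq)))

≡ᵇ-true⇒≡ : ∀ {m n} → (m ≡ᵇ n) ≡ true → m ≡ n
≡ᵇ-true⇒≡ {m} {n} eq = ℕ.≡ᵇ⇒≡ m n (subst T (sym eq) tt)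

count-absent : ∀ {x} vs → All (x ≢_) vs → count (x ≡ᵇ_) vs ≡ 0
count-absent         []       []         = refl
count-absent {x} (v ∷ vs) (x≢v ∷ x∉vs) with x ≡ᵇ v in eq
... | true  = ⊥-elim (x≢v (≡ᵇ-true⇒≡ eq))
... | false = count-absent vs x∉vs

count-unique : ∀ {x vs} → Unique vs → x ∈ vs → count (x ≡ᵇ_) vs ≡ 1
count-unique {x} {v ∷ vs} (v∉vs ∷ u) x∈v∷vs with x ≡ᵇ v in eq | x∈v∷vs
... | true  | here refl   = cong suc (count-absent vs v∉vs)
... | true  | there x∈vs = ⊥-elim (All.lookup v∉vs x∈vs (sym (≡ᵇ-true⇒≡ eq)))
... | false | here refl   = ⊥-elim (subst T eq (ℕ.≡⇒≡ᵇ x x refl))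
... | false | there x∈vs = count-unique u x∈vs

multiplicities : List ℕ → List ℕ → List ℕ
multiplicities xs vs = map (λ v → count (_≡ᵇ v) xs) vs

sum-multiplicities-∷ : ∀ x xs vs →
  sum (multiplicities (x ∷ xs) vs) ≡ count (x ≡ᵇ_) vs ℕ.+ sum (multiplicities xs vs)
sum-multiplicities-∷ x xs []       = refl
sum-multiplicities-∷ x xs (v ∷ vs) with x ≡ᵇ v
... | true  = cong suc (trans (cong (count (_≡ᵇ v) xs ℕ.+_) (sum-multiplicities-∷ x xs vs))
                              (x∙yz≈y∙xz (count (_≡ᵇ v) xs) (count (x ≡ᵇ_) vs) (sum (multiplicities xs vs))))
... | false = trans (cong (count (_≡ᵇ v) xs ℕ.+_) (sum-multiplicities-∷ x xs vs))
                    (x∙yz≈y∙xz (count (_≡ᵇ v) xs) (count (x ≡ᵇ_) vs) (sum (multiplicities xs vs)))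

sum-multiplicities : ∀ {vs} xs → Unique vs → All (_∈ vs) xs → sum (multiplicities xs vs) ≡ length xs
sum-multiplicities {vs} []       _ []            = sum-zeros vs
  where
  sum-zeros : ∀ vs → sum (multiplicities [] vs) ≡ 0
  sum-zeros []       = refl
  sum-zeros (_ ∷ vs) = sum-zeros vs
sum-multiplicities {vs} (x ∷ xs) u (x∈vs ∷ xs⊆vs) = begin
  sum (multiplicities (x ∷ xs) vs)                ≡⟨ sum-multiplicities-∷ x xs vs ⟩
  count (x ≡ᵇ_) vs ℕ.+ sum (multiplicities xs vs) ≡⟨ cong₂ ℕ._+_ (count-unique u x∈vs) (sum-multiplicities xs u xs⊆vs) ⟩
  suc (length xs)                                 ∎
  where open ≡-Reasoning

range-unique : ∀ m → Unique (range 1 m)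
range-unique m = Unique.map⁺ (ℕ.+-cancelʳ-≡ 1 _ _) (Unique.upTo⁺ m)

∈-range : ∀ {m x} → 0 ℕ.< x → x ℕ.≤ m → x ∈ range 1 m
∈-range {m} {suc y} _ y<m = subst (_∈ range 1 m) (ℕ.+-comm y 1) (∈-map⁺ (ℕ._+ 1) (∈-upTo⁺ y<m))

≤-foldr-⊔ : ∀ xs → All (ℕ._≤ foldr _⊔_ 0 xs) xs
≤-foldr-⊔ []       = []
≤-foldr-⊔ (x ∷ xs) = ℕ.m≤m⊔n x _ ∷ All.map (λ x≤max → ℕ.≤-trans x≤max (ℕ.m≤n⊔m x _)) (≤-foldr-⊔ xs)

entries : Tableau → List ℕ
entries = concatMap (λ r → r)

sum-wt : ∀ t → All Positive t → sum (wt t) ≡ length (entries t)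
sum-wt t pos = sum-multiplicities (entries t) (range-unique (maxEntry t))
  (All.zipWith (λ (0<x , x≤max) → ∈-range 0<x x≤max) (All.concat⁺ (All.map⁺ pos) , ≤-foldr-⊔ (entries t)))

IsFilling : List ℕ → Tableau → Set
IsFilling γ t = length (entries t) ≡ size γ × All Positive t

range-positive : ∀ m → Positive (range 1 m)
range-positive m = All.map⁺ (All.universal (λ i → ℕ.m≤n+m 1 i) (upTo m))

rowsOf-valid : ∀ N a → All (λ r → length r ≡ a × Positive r) (rowsOf N a)
rowsOf-valid N zero    = (refl , []) ∷ []
rowsOf-valid N (suc a) = All.concat⁺ (All.map⁺ (All.map (λ 0<x →
  All.map⁺ (All.map (λ (len , pos) → cong suc len , 0<x ∷ pos) (rowsOf-valid N a))) (range-positive N)))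

fillings-valid : ∀ N γ → All (IsFilling γ) (fillings N γ)
fillings-valid N []      = (refl , []) ∷ []
fillings-valid N (a ∷ γ) = All.concat⁺ (All.map⁺ (All.map (λ {r} (len-r , pos-r) →
  All.map⁺ (All.map (λ {t} (len-t , pos-t) → trans (length-++ r) (cong₂ ℕ._+_ len-r len-t) , pos-r ∷ pos-t)
                    (fillings-valid N γ))) (rowsOf-valid N a)))

PCT-valid : ∀ γ → All (IsFilling γ) (PCT γ)
PCT-valid γ = All.filter⁺ (T? ∘ _) (fillings-valid (size γ) γ)

eqList⇒≡ : ∀ a b → T (eqList a b) → a ≡ b
eqList⇒≡ []      []      _ = refl
eqList⇒≡ (x ∷ a) (y ∷ b) h with x ≡ᵇ y in eq
... | true  = cong₂ _∷_ (≡ᵇ-true⇒≡ eq) (eqList⇒≡ a b h)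

sum-support : ∀ e → sum (support e) ≡ sum e
sum-support []          = refl
sum-support (zero ∷ e)  = sum-support e
sum-support (suc n ∷ e) = cong (suc n ℕ.+_) (sum-support e)

M-vanishes : ∀ β e → sum e ≢ sum β → M β e ≡ 0ℚ
M-vanishes β e ne with eqList (support e) β in eq
... | true  = ⊥-elim (ne (trans (sym (sum-support e)) (cong sum (eqList⇒≡ (support e) β (subst T (sym eq) tt)))))
... | false = refl

sumℚ-zeros : ∀ {qs} → All (_≡ 0ℚ) qs → sumℚ qs ≡ 0ℚ
sumℚ-zeros []             = refl
sumℚ-zeros (refl ∷ zeros) = cong (0ℚ +_) (sumℚ-zeros zeros)

tableauFactor : Tableau → ℚ
tableauFactor t = pow (fromℕ 2) (pStat t) * pow ½ (mStat t)

Phat-vanishes : ∀ γ e → sum e ≢ size γ → Phat γ e ≡ 0ℚ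
Phat-vanishes γ e ne = sumℚ-zeros (All.map⁺ (All.map term-vanishes (PCT-valid γ)))
  where
  term-vanishes : ∀ {t} → IsFilling γ t → tableauFactor t * M (wt t) e ≡ 0ℚ
  term-vanishes {t} (len , pos) = trans (cong (tableauFactor t *_) (M-vanishes (wt t) e degree≢)) (*-zeroʳ (tableauFactor t))
    where
    degree≢ : sum e ≢ sum (wt t)
    degree≢ eq = ne (trans eq (trans (sum-wt t pos) len))

*-nonneg : ∀ {p q} → 0ℚ ≤ p → 0ℚ ≤ q → 0ℚ ≤ p * q
*-nonneg {p} {q} 0≤p 0≤q = nonNegative⁻¹ _ {{nonNeg*nonNeg⇒nonNeg p {{nonNegative 0≤p}} q {{nonNegative 0≤q}}}}

pow-nonneg : ∀ {q} n → 0ℚ ≤ q → 0ℚ ≤ pow q n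
pow-nonneg zero    _   = toWitness {a? = 0ℚ ≤? 1ℚ} tt
pow-nonneg (suc n) 0≤q = *-nonneg 0≤q (pow-nonneg n 0≤q)

M-nonneg : ∀ β e → 0ℚ ≤ M β e
M-nonneg β e with eqList (support e) β
... | true  = toWitness {a? = 0ℚ ≤? 1ℚ} tt
... | false = ≤-refl

sumℚ-nonneg : ∀ {qs} → All (0ℚ ≤_) qs → 0ℚ ≤ sumℚ qs
sumℚ-nonneg []           = ≤-refl
sumℚ-nonneg (0≤q ∷ 0≤qs) = +-mono-≤ 0≤q (sumℚ-nonneg 0≤qs)

Phat-nonneg : ∀ γ e → 0ℚ ≤ Phat γ e
Phat-nonneg γ e = sumℚ-nonneg (All.map⁺ (All.universal term-nonneg (PCT γ)))
  where
  term-nonneg : ∀ t → 0ℚ ≤ tableauFactor t * M (wt t) e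
  term-nonneg t = *-nonneg (*-nonneg (pow-nonneg (pStat t) (toWitness {a? = 0ℚ ≤? fromℕ 2} tt))
                                     (pow-nonneg (mStat t) (toWitness {a? = 0ℚ ≤? ½} tt)))
                           (M-nonneg (wt t) e)

e₁₁₃ e₁₃₁ : List ℕ
e₁₁₃ = 1 ∷ 1 ∷ 3 ∷ []
e₁₃₁ = 1 ∷ 3 ∷ 1 ∷ []

Phat₁₁₃≤Phat₁₃₁-size5 : All (λ γ → Phat γ e₁₁₃ ≤ Phat γ e₁₃₁) (compositions 5)
Phat₁₁₃≤Phat₁₃₁-size5 = from-yes (all? (λ γ → Phat γ e₁₁₃ ≤? Phat γ e₁₃₁) (compositions 5))

Phat₁₁₃≤Phat₁₃₁ : ∀ γ → Peak γ → Phat γ e₁₁₃ ≤ Phat γ e₁₃₁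
Phat₁₁₃≤Phat₁₃₁ γ peak with size γ ℕ.≟ 5
... | yes size≡5 = All.lookup Phat₁₁₃≤Phat₁₃₁-size5 (∈-compositions 5 γ (peak⇒positive γ peak) size≡5)
... | no  size≢5 = subst (_≤ Phat γ e₁₃₁) (sym (Phat-vanishes γ e₁₁₃ (size≢5 ∘ sym))) (Phat-nonneg γ e₁₃₁)

linComb-mono : ∀ e e′ → (∀ γ → Peak γ → Phat γ e ≤ Phat γ e′) →
  ∀ L → All (λ γc → Peak (proj₁ γc) × 0ℚ ≤ proj₂ γc) L → linComb L e ≤ linComb L e′
linComb-mono e e′ Phat≤ []            []                 = ≤-refl
linComb-mono e e′ Phat≤ ((γ , c) ∷ L) ((peak , 0≤c) ∷ ps) =
  +-mono-≤ (*-monoˡ-≤-nonNeg c {{nonNegative 0≤c}} (Phat≤ γ peak)) (linComb-mono e e′ Phat≤ L ps)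

Phat₂₂Phat₁-113≰131 : ¬ ((Phat (2 ∷ 2 ∷ []) ⊛ Phat (1 ∷ [])) e₁₁₃ ≤ (Phat (2 ∷ 2 ∷ []) ⊛ Phat (1 ∷ [])) e₁₃₁)
Phat₂₂Phat₁-113≰131 = toWitnessFalse {a? = _ ≤? _} tt

mainTheorem8 : Σ (List ℕ) λ α → Σ (List ℕ) λ β → Peak α × Peak β ×
    ¬ (Σ (List (List ℕ × ℚ)) λ L →
         All (λ γc → Peak (proj₁ γc) × 0ℚ ≤ proj₂ γc) L ×
         (∀ (e : List ℕ) → (Phat α ⊛ Phat β) e ≡ linComb L e))
mainTheorem8 = (2 ∷ 2 ∷ []) , (1 ∷ []) , tt , tt , λ (L , nonneg , expansion) →
  Phat₂₂Phat₁-113≰131 (subst₂ _≤_ (sym (expansion e₁₁₃)) (sym (expansion e₁₃₁))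
                                  (linComb-mono e₁₁₃ e₁₃₁ Phat₁₁₃≤Phat₁₃₁ L nonneg))
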